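{- Let $(D,X,H)$ be a degree-feasible configuration that is uncolorable. Then: (a) $|X_v|=d_D^+(v)=d_D^-(v)$ for all $v\in V(D)$; in particular $D$ is Eulerian. (b) For every $v\in V(D)$, the pair $(X',H')=(X,H)/v$ has an acyclic transversal. (c) Let $v\in V(D)$, let $T$ be an acyclic transversal of $(X',H')=(X,H)/v$, and let $T^+=\bigcup_{u\in N_D^+(v)}(X_u\cap T)$ and $T^-=\bigcup_{u\in N_D^-(v)}(X_u\cap T)$. Then the arcs of $H$ from $X_v$ to $T^+$ form a perfect matching of $H[X_v\cup T^+]$, and the arcs of $H$ from $T^-$ to $X_v$ form a perfect matching of $H[X_v\cup T^-]$.
   Context: Digraphs are finite, without loops and parallel arcs (opposite arcs allowed); connectivity means weak connectivity. A digraph is Eulerian if $d^+(v)=d^-(v)$ for every vertex. $N_D^+(v)$, $N_D^-(v)$ denote the sets of out- and in-neighbors of $v$. A matching in a digraph is a set of arcs with no common end-vertices; it is perfect if it covers all vertices. A cover of a digraph $D$ is a pair $(X,H)$: pairwise disjoint sets $X_v$ ($v\in V(D)$), and a digraph $H$ on $\bigcup_v X_v$ with each $X_v$ independent, such that for each arc $uv\in A(D)$ the arcs of $H$ from $X_u$ to $X_v$ form a (possibly empty) matching and every arc of $H$ arises in this way. A feasible configuration is a triple $(D,X,H)$ with $D$ connected and $(X,H)$ a cover of $D$; it is degree-feasible if $|X_v|\ge\max\{d_D^+(v),d_D^-(v)\}$ for all $v$. An acyclic transversal of $(X,H)$ is a set $T\subseteq V(H)$ with $|T\cap X_v|=1$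 for all $v$ and $H[T]$ containing no directed cycle; $(D,X,H)$ is colorable if one exists, uncolorable otherwise. For $v\in V(D)$, $(X,H)/v$ denotes the cover $(X',H')$ of $D-v$ where $X'$ is the restriction of $X$ to $V(D)\setminus\{v\}$ and $H'=H-X_v$. -}

module Defs where

open import Data.Nat using (ℕ; zero; suc; _+_; _⊔_; _≤_)
open import Data.Fin using (Fin; zero; suc; inject₁; fromℕ; _≟_)
open import Data.Bool using (Bool; true; false; _∧_; _∨_; if_then_else_)
open import Data.Product using (Σ; ∃; ∃-syntax; _×_; _,_)
open import Data.Sum using (_⊎_)
open import Relation.Binary.PropositionalEquality using (_≡_; _≢_)
open import Relation.Nullary using (¬_; does)
open import Function.Definitions using (Injective)

count : ∀ {k} → (Fin k → Bool) → ℕ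
count {zero}  p = 0
count {suc k} p = (if p zero then 1 else 0) + count (λ i → p (suc i))

-- Digraphs on vertex set Fin n, given by a Boolean adjacency relation:
-- A u v ≡ true  iff  uv is an arc.  (No parallel arcs by construction;
-- opposite arcs allowed.)

Adj : ℕ → Set
Adj n = Fin n → Fin n → Bool

Loopless : ∀ {n} → Adj n → Set
Loopless A = ∀ v → A v v ≡ false

data WeakWalk {n} (A : Adj n) : Fin n → Fin n → Set where
  here : ∀ {u} → WeakWalk A u u
  fwd  : ∀ {u w v} → A u w ≡ true → WeakWalk A w v → WeakWalk A u v
  bwd  : ∀ {u w v} → A w u ≡ true → WeakWalk A w v → WeakWalk A u v

Connected : ∀ {n} → Adj n → Set
Connected A = ∀ u v → WeakWalk A u v

outdeg : ∀ {n} → Adj n → Fin n → ℕ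
outdeg A v = count (λ w → A v w)

indeg : ∀ {n} → Adj n → Fin n → ℕ
indeg A v = count (λ w → A w v)

Eulerian : ∀ {n} → Adj n → Set
Eulerian A = ∀ v → outdeg A v ≡ indeg A v

ArcSet : ℕ → Set₁
ArcSet m = Fin m → Fin m → Set

arcs : ∀ {m} → Adj m → ArcSet m
arcs B x y = B x y ≡ true

IsMatching : ∀ {m} → ArcSet m → Set
IsMatching M = ∀ {x y x' y'} → M x y → M x' y' →
  (x ≡ x' ⊎ x ≡ y' ⊎ y ≡ x' ⊎ y ≡ y') → (x ≡ x' × y ≡ y')

Induced : ∀ {m} → ArcSet m → (Fin m → Bool) → ArcSet m
Induced R S x y = S x ≡ true × S y ≡ true × R x y

IsPerfectMatchingOf : ∀ {m} → ArcSet m → (Fin m → Bool) → ArcSet m → Set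
IsPerfectMatchingOf M S G =
  (∀ x y → M x y → G x y) × IsMatching M ×
  (∀ z → S z ≡ true → ∃[ x ] ∃[ y ] (M x y × (z ≡ x ⊎ z ≡ y)))

DirCycle : ∀ {m} → ArcSet m → Set
DirCycle {m} R = Σ ℕ λ k → Σ (Fin (suc k) → Fin m) λ c →
  Injective _≡_ _≡_ c ×
  (∀ (i : Fin k) → R (c (inject₁ i)) (c (suc i))) ×
  R (c (fromℕ k)) (c zero)

Acyclic : ∀ {m} → ArcSet m → Set
Acyclic R = ¬ DirCycle R

-- V(H) = Fin m, and π : Fin m → Fin n assigns each vertex of H
-- to the (unique) class X_v containing it, i.e. X_v = π⁻¹(v).  Thus the
-- X_v are pairwise disjoint and their union is V(H).  H is given by the
-- adjacency B.

inX : ∀ {n m} → (Fin m → Fin n) → Fin n → Fin m → Bool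
inX π v x = does (π x ≟ v)

size : ∀ {n m} → (Fin m → Fin n) → Fin n → ℕ
size π v = count (inX π v)

arcsBetween : ∀ {n m} → (Fin m → Fin n) → Adj m → Fin n → Fin n → ArcSet m
arcsBetween π B u v x y = π x ≡ u × π y ≡ v × B x y ≡ true

IsCover : ∀ {n m} → Adj n → (Fin m → Fin n) → Adj m → Set
IsCover A π B =
  (∀ x y → B x y ≡ true → π x ≢ π y) ×
  (∀ x y → B x y ≡ true → A (π x) (π y) ≡ true) ×
  (∀ u v → A u v ≡ true → IsMatching (arcsBetween π B u v))

FeasibleConfig : ∀ {n m} → Adj n → (Fin m → Fin n) → Adj m → Set
FeasibleConfig A π B = Loopless A × Connected A × IsCover A π B

DegreeFeasible : ∀ {n m} → Adj n → (Fin m → Fin n) → Set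
DegreeFeasible A π = ∀ v → outdeg A v ⊔ indeg A v ≤ size π v

IsTransversal : ∀ {n m} → (Fin m → Fin n) → (Fin m → Bool) → Set
IsTransversal π T = ∀ v → count (λ x → inX π v x ∧ T x) ≡ 1

IsAcyclicTransversal : ∀ {n m} → (Fin m → Fin n) → Adj m → (Fin m → Bool) → Set
IsAcyclicTransversal π B T = IsTransversal π T × Acyclic (Induced (arcs B) T)

Colorable : ∀ {n m} → (Fin m → Fin n) → Adj m → Set
Colorable π B = ∃[ T ] IsAcyclicTransversal π B T

-- The cover (X,H)/v of D - v: classes X_u (u ≠ v), digraph H' = H - X_v.
-- Vertices of H' are the vertices of H outside X_v.
arcsDel : ∀ {n m} → (Fin m → Fin n) → Adj m → Fin n → ArcSet m
arcsDel π B v x y = π x ≢ v × π y ≢ v × B x y ≡ true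

IsTransversalDel : ∀ {n m} → (Fin m → Fin n) → Fin n → (Fin m → Bool) → Set
IsTransversalDel π v T =
  (∀ x → T x ≡ true → π x ≢ v) ×
  (∀ u → u ≢ v → count (λ x → inX π u x ∧ T x) ≡ 1)

IsAcyclicTransversalDel : ∀ {n m} → (Fin m → Fin n) → Adj m → Fin n → (Fin m → Bool) → Set
IsAcyclicTransversalDel π B v T =
  IsTransversalDel π v T × Acyclic (Induced (arcsDel π B v) T)

Tplus : ∀ {n m} → Adj n → (Fin m → Fin n) → Fin n → (Fin m → Bool) → Fin m → Bool
Tplus A π v T x = T x ∧ A v (π x)

Tminus : ∀ {n m} → Adj n → (Fin m → Fin n) → Fin n → (Fin m → Bool) → Fin m → Bool
Tminus A π v T x = T x ∧ A (π x) v

arcsFromTo : ∀ {m} → Adj m → (Fin m → Bool) → (Fin m → Bool) → ArcSet m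
arcsFromTo B S S' x y = S x ≡ true × S' y ≡ true × B x y ≡ true

_∪_ : ∀ {m} → (Fin m → Bool) → (Fin m → Bool) → Fin m → Bool
(S ∪ S') x = S x ∨ S' x

-- A vertex x that is a sink or a source of H[T + x] can be added to an acyclic set T
-- (acyclic-insert).  Whether such an x exists in a class X_u is decided by counting: the arcs
-- of H leaving X_u form matchings, so if every x ∈ X_u had an out-neighbour in T, sending x to
-- the class of that neighbour would inject X_u into the out-neighbour classes of u meeting T
-- (module Orientation; likewise for in-neighbours with H reversed).
-- (b) Colour D - v greedily, classes farthest from v first (module Greedy): the class u being
--     coloured has a closer uncoloured neighbour, so fewer than d(u) ≤ |X_u| of its neighbour
--     classes meet T, and some x ∈ X_u is a sink or a source.
-- (c) Given T, no x ∈ X_v is a sink or a source, or D would be colorable; so X_v injects into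
--     T⁺, which injects into N⁺(v), and |N⁺(v)| ≤ |X_v| makes both bijections: the arcs from
--     X_v to T⁺ form a perfect matching, and likewise for T⁻ (module Saturated).
-- (a) follows by applying (c) to the transversal provided by (b).

module Submission where

open import Defs
open import Data.Bool using (Bool; true; false; _∧_; _∨_; not; if_then_else_)
open import Data.Bool.Properties using (∧-zeroʳ; ∨-identityʳ; ¬-not) renaming (_≟_ to _≟ᵇ_)
open import Data.Empty using (⊥; ⊥-elim)
open import Data.Fin using (Fin; zero; suc; inject₁; fromℕ; _≟_)
open import Data.Fin.Properties using (suc-injective; any?)
open import Data.Nat using (ℕ; zero; suc; pred; _+_; _≤_; _<_; z≤n; s≤s)
open import Data.Nat.Properties using (m≤m⊔n; m≤n⊔m; ≤-refl; ≤-trans; ≤-reflexive; ≤-antisym; ≤-total)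
open import Data.Nat.Properties using (≤-<-connex; n≤0⇒n≡0; n≮0; <⇒≱; 1+n≰n; +-suc)
open import Data.Product using (∃; ∃-syntax; _×_; _,_; proj₁; proj₂)
open import Data.Sum using (_⊎_; inj₁; inj₂; [_,_]′; swap)
open import Relation.Binary.PropositionalEquality using (_≡_; _≢_; refl; sym; trans; cong; subst)
open import Relation.Nullary using (¬_; Dec; does; yes; no)
open import Relation.Nullary.Decidable using (dec-true; dec-false; _×-dec_)

∧-elimˡ : ∀ {a b} → a ∧ b ≡ true → a ≡ true
∧-elimˡ {true} _ = refl

∧-elimʳ : ∀ {a b} → a ∧ b ≡ true → b ≡ true
∧-elimʳ {true} ab = ab

∧-intro : ∀ {a b} → a ≡ true → b ≡ true → a ∧ b ≡ true
∧-intro refl refl = refl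

∨-introˡ : ∀ {a b} → a ≡ true → a ∨ b ≡ true
∨-introˡ refl = refl

∨-introʳ : ∀ {a b} → b ≡ true → a ∨ b ≡ true
∨-introʳ {true} _ = refl
∨-introʳ {false} b = b

∨-elim : ∀ {a b} → a ∨ b ≡ true → a ≡ true ⊎ b ≡ true
∨-elim {true} _ = inj₁ refl
∨-elim {false} b = inj₂ b

does-sound : ∀ {P : Set} (P? : Dec P) → does P? ≡ true → P
does-sound (yes p) _ = p

true≢false : true ≢ false
true≢false ()

not-elim : ∀ {a} → not a ≡ true → a ≡ false
not-elim {false} _ = refl

remove : ∀ {k} → (Fin k → Bool) → Fin k → Fin k → Bool
remove q y z = not (does (z ≟ y)) ∧ q z

insert : ∀ {k} → (Fin k → Bool) → Fin k → Fin k → Bool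
insert q y z = q z ∨ does (z ≟ y)

remove-intro : ∀ {k} {q : Fin k → Bool} {y z} → z ≢ y → q z ≡ true → remove q y z ≡ true
remove-intro {y = y} {z} z≢y qz = ∧-intro (cong not (dec-false (z ≟ y) z≢y)) qz

remove-elim : ∀ {k} {q : Fin k → Bool} {y z} → remove q y z ≡ true → z ≢ y × q z ≡ true
remove-elim {y = y} {z} r with z ≟ y
... | no z≢y = z≢y , r

insert-old : ∀ {k} {q : Fin k → Bool} {y z} → insert q y z ≡ true → z ≢ y → q z ≡ true
insert-old {q = q} {y} {z} r z≢y with ∨-elim {q z} r
... | inj₁ qz = qz
... | inj₂ z≡y = ⊥-elim (z≢y (does-sound (z ≟ y) z≡y))

count-cong : ∀ {k} {p q : Fin k → Bool} → (∀ x → p x ≡ q x) → count p ≡ count q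
count-cong {zero} _ = refl
count-cong {suc k} {p} {q} p≗q rewrite p≗q zero =
  cong ((if q zero then 1 else 0) +_) (count-cong (λ x → p≗q (suc x)))

count-empty : ∀ {k} (p : Fin k → Bool) → (∀ x → p x ≡ false) → count p ≡ 0
count-empty {zero} _ _ = refl
count-empty {suc k} p empty rewrite empty zero = count-empty (λ x → p (suc x)) (λ x → empty (suc x))

count-remove : ∀ {k} (q : Fin k → Bool) y → q y ≡ true → suc (count (remove q y)) ≡ count q
count-remove q zero qy rewrite qy = refl
count-remove {suc k} q (suc y) qy =
  trans (sym (+-suc (if q zero then 1 else 0) _))
        (cong ((if q zero then 1 else 0) +_) (count-remove (λ x → q (suc x)) y qy))

count-member : ∀ {k} (q : Fin k → Bool) y → q y ≡ true → 1 ≤ count q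
count-member q y qy = subst (1 ≤_) (count-remove q y qy) (s≤s z≤n)

count-positive : ∀ {k} (q : Fin k → Bool) → 1 ≤ count q → ∃ λ x → q x ≡ true
count-positive {suc k} q pos with q zero in q0
... | true = zero , q0
... | false with count-positive (λ x → q (suc x)) pos
...   | x , qx = suc x , qx

count-one : ∀ {k} (q : Fin k → Bool) x → q x ≡ true → (∀ y → q y ≡ true → y ≡ x) → count q ≡ 1
count-one q x qx only = trans (sym (count-remove q x qx)) (cong suc (count-empty (remove q x) rest))
  where
  rest : ∀ y → remove q x y ≡ false
  rest y with q y in qy
  ... | false = ∧-zeroʳ (not (does (y ≟ x)))
  ... | true rewrite dec-true (y ≟ x) (only y qy) = refl

count-one-unique : ∀ {k} (q : Fin k → Bool) → count q ≡ 1 → ∀ {x y} → q x ≡ true → q y ≡ true → x ≡ y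
count-one-unique q one {x} {y} qx qy with x ≟ y
... | yes x≡y = x≡y
... | no x≢y = ⊥-elim (1+n≰n (subst (2 ≤_) (trans (count-remove q x qx) one) two≤))
  where
  two≤ : 2 ≤ suc (count (remove q x))
  two≤ = s≤s (count-member (remove q x) y (remove-intro {q = q} (λ y≡x → x≢y (sym y≡x)) qy))

count-≤-injective : ∀ {k l} (p : Fin k → Bool) (q : Fin l → Bool) (R : Fin k → Fin l → Set) →
  (∀ x → p x ≡ true → ∃ λ y → q y ≡ true × R x y) →
  (∀ {x x' y} → p x ≡ true → p x' ≡ true → R x y → R x' y → x ≡ x') →
  count p ≤ count q
count-≤-injective {zero} _ _ _ _ _ = z≤n
count-≤-injective {suc k} p q R partner injective with p zero in p0
... | false = count-≤-injective (λ x → p (suc x)) q (λ x → R (suc x))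
                (λ x → partner (suc x)) (λ px px' r r' → suc-injective (injective px px' r r'))
... | true with partner zero p0
...   | y₀ , qy₀ , r₀ = ≤-trans (s≤s rest) (≤-reflexive (count-remove q y₀ qy₀))
  where
  rest : count (λ x → p (suc x)) ≤ count (remove q y₀)
  rest = count-≤-injective (λ x → p (suc x)) (remove q y₀) (λ x → R (suc x))
    (λ x px → let (y , qy , r) = partner (suc x) px
              in y , remove-intro {q = q} (λ { refl → 0≢suc (injective p0 px r₀ r) }) qy , r)
    (λ px px' r r' → suc-injective (injective px px' r r'))
    where
    0≢suc : ∀ {x : Fin k} → Fin.zero ≢ suc x
    0≢suc ()

injective-onto : ∀ {k l} (p : Fin k → Bool) (q : Fin l → Bool) (R : Fin k → Fin l → Bool) →
  (∀ x → p x ≡ true → ∃ λ y → q y ≡ true × R x y ≡ true) →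
  (∀ {x x' y} → p x ≡ true → p x' ≡ true → R x y ≡ true → R x' y ≡ true → x ≡ x') →
  count q ≤ count p →
  ∀ y → q y ≡ true → ∃ λ x → p x ≡ true × R x y ≡ true
injective-onto p q R partner injective q≤p y qy with any? (λ x → p x ∧ R x y ≟ᵇ true)
... | yes (x , pR) = x , ∧-elimˡ pR , ∧-elimʳ pR
... | no unmatched = ⊥-elim (1+n≰n (≤-trans (subst (_≤ count p) (sym (count-remove q y qy)) q≤p) p≤))
  where
  p≤ : count p ≤ count (remove q y)
  p≤ = count-≤-injective p (remove q y) (λ x y' → R x y' ≡ true)
    (λ x px → let (y' , qy' , r) = partner x px
              in y' , remove-intro {q = q} (λ { refl → unmatched (x , ∧-intro px r) }) qy' , r)
    injective

injective-functional : ∀ {k l} (p : Fin k → Bool) (q : Fin l → Bool) (R : Fin k → Fin l → Set) →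
  (∀ x → p x ≡ true → ∃ λ y → q y ≡ true × R x y) →
  (∀ {x x' y} → p x ≡ true → p x' ≡ true → R x y → R x' y → x ≡ x') →
  count q ≤ count p →
  ∀ {x y y'} → p x ≡ true → q y ≡ true → q y' ≡ true → R x y → R x y' → y ≡ y'
injective-functional p q R partner injective q≤p {x} {y} {y'} px qy qy' r r' with y ≟ y'
... | yes y≡y' = y≡y'
... | no y≢y' =
  ⊥-elim (1+n≰n (≤-trans (≤-reflexive q≡) (≤-trans q≤p (≤-trans (≤-reflexive (sym p≡)) (s≤s p-x≤)))))
  where
  q-y-y' = remove (remove q y) y'
  p≡ : suc (count (remove p x)) ≡ count p
  p≡ = count-remove p x px
  q≡ : suc (suc (count q-y-y')) ≡ count q
  q≡ = trans (cong suc (count-remove (remove q y) y' (remove-intro {q = q} (λ e → y≢y' (sym e)) qy')))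
             (count-remove q y qy)
  p-x≤ : count (remove p x) ≤ count q-y-y'
  p-x≤ = count-≤-injective (remove p x) q-y-y' R
    (λ x'' px'' → let (x''≢x , px''') = remove-elim {q = p} px''
                      (y'' , qy'' , r'') = partner x'' px'''
                  in y'' , remove-intro {q = remove q y}
                             (λ { refl → x''≢x (injective px''' px r'' r') })
                             (remove-intro {q = q} (λ { refl → x''≢x (injective px''' px r'' r) }) qy'') , r'')
    (λ px₁ px₂ → injective (proj₂ (remove-elim {q = p} px₁)) (proj₂ (remove-elim {q = p} px₂)))

acyclic-sub : ∀ {m} (R R' : ArcSet m) → (∀ {x y} → R' x y → R x y) → Acyclic R → Acyclic R'
acyclic-sub _ _ R'⊆R acyclic (k , c , injective , step , close) =
  acyclic (k , c , injective , (λ i → R'⊆R (step i)) , R'⊆R close)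

last-or-inject₁ : ∀ {k} (i : Fin (suc k)) → i ≡ fromℕ k ⊎ ∃ λ (j : Fin k) → i ≡ inject₁ j
last-or-inject₁ {zero} zero = inj₁ refl
last-or-inject₁ {suc k} zero = inj₂ (zero , refl)
last-or-inject₁ {suc k} (suc i) with last-or-inject₁ i
... | inj₁ i≡last = inj₁ (cong suc i≡last)
... | inj₂ (j , i≡j) = inj₂ (suc j , cong suc i≡j)

cycle-successor : ∀ {m} {R : ArcSet m} k (c : Fin (suc k) → Fin m) →
  (∀ (i : Fin k) → R (c (inject₁ i)) (c (suc i))) → R (c (fromℕ k)) (c zero) →
  ∀ i → ∃ λ j → R (c i) (c j)
cycle-successor k c step close i with last-or-inject₁ i
... | inj₁ refl = zero , close
... | inj₂ (j , refl) = suc j , step j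

cycle-predecessor : ∀ {m} {R : ArcSet m} k (c : Fin (suc k) → Fin m) →
  (∀ (i : Fin k) → R (c (inject₁ i)) (c (suc i))) → R (c (fromℕ k)) (c zero) →
  ∀ i → ∃ λ j → R (c j) (c i)
cycle-predecessor k c step close zero = fromℕ k , close
cycle-predecessor k c step close (suc j) = inject₁ j , step j

Sink : ∀ {m} → Adj m → (Fin m → Bool) → Fin m → Set
Sink E T x = ∀ y → T y ≡ true → E x y ≡ false

SinkOrSource : ∀ {m} → Adj m → (Fin m → Bool) → Fin m → Set
SinkOrSource B T x = Sink B T x ⊎ Sink (λ x y → B y x) T x

-- Adding a sink or a source to an acyclic set keeps it acyclic: a directed cycle through x
-- would contain both an arc leaving x and an arc entering x.
acyclic-insert : ∀ {m} (B : Adj m) (T : Fin m → Bool) x → (∀ y → B y y ≡ false) →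
  Acyclic (Induced (arcs B) T) → SinkOrSource B T x → Acyclic (Induced (arcs B) (insert T x))
acyclic-insert B T x loopless acyclic sinkOrSource (k , c , injective , step , close)
  with any? (λ i → c i ≟ x)
... | no avoids = acyclic (k , c , injective , (λ i → shrink (step i)) , shrink close)
  where
  shrink : ∀ {i j} → Induced (arcs B) (insert T x) (c i) (c j) → Induced (arcs B) T (c i) (c j)
  shrink {i} {j} (ti , tj , b) =
    insert-old {q = T} ti (λ e → avoids (i , e)) , insert-old {q = T} tj (λ e → avoids (j , e)) , b
... | yes (i , refl) = not-on-cycle sinkOrSource
  where
  R = Induced (arcs B) (insert T (c i))

  -- the neighbours of x = c i on the cycle differ from x (H has no loops), so they lie in T
  not-on-cycle : SinkOrSource B T (c i) → ⊥
  not-on-cycle (inj₁ sink) with cycle-successor {R = R} k c step close i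
  ... | j , (_ , tj , b) = true≢false (trans (sym b) (sink (c j) (insert-old {q = T} tj cj≢ci)))
    where
    cj≢ci : c j ≢ c i
    cj≢ci e = true≢false (trans (sym b) (subst (λ z → B (c i) z ≡ false) (sym e) (loopless (c i))))
  not-on-cycle (inj₂ source) with cycle-predecessor {R = R} k c step close i
  ... | j , (tj , _ , b) = true≢false (trans (sym b) (source (c j) (insert-old {q = T} tj cj≢ci)))
    where
    cj≢ci : c j ≢ c i
    cj≢ci e = true≢false (trans (sym b) (subst (λ z → B z (c i) ≡ false) (sym e) (loopless (c i))))

module CoverFacts {n m} {A : Adj n} {π : Fin m → Fin n} {B : Adj m} (cover : IsCover A π B) where

  H-loopless : ∀ y → B y y ≡ false
  H-loopless y with B y y in byy
  ... | false = refl
  ... | true = ⊥-elim (proj₁ cover y y byy refl)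

  arc-projects : ∀ {x y} → B x y ≡ true → A (π x) (π y) ≡ true
  arc-projects = proj₁ (proj₂ cover) _ _

  in-unique : ∀ {x x' y} → π x ≡ π x' → B x y ≡ true → B x' y ≡ true → x ≡ x'
  in-unique {x} {y = y} πx≡πx' b b' =
    proj₁ (proj₂ (proj₂ cover) (π x) (π y) (arc-projects b)
            (refl , refl , b) (sym πx≡πx' , refl , b') (inj₂ (inj₂ (inj₂ refl))))

  out-unique : ∀ {x y y'} → π y ≡ π y' → B x y ≡ true → B x y' ≡ true → y ≡ y'
  out-unique {x} {y} πy≡πy' b b' =
    proj₂ (proj₂ (proj₂ cover) (π x) (π y) (arc-projects b)
            (refl , refl , b) (refl , sym πy≡πy' , b') (inj₁ refl))

record PartialTransversal {n m} (π : Fin m → Fin n) (B : Adj m) (U : Fin n → Bool)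
                          (T : Fin m → Bool) : Set where
  field
    within   : ∀ x → T x ≡ true → U (π x) ≡ true
    one-each : ∀ u → U u ≡ true → count (λ x → inX π u x ∧ T x) ≡ 1
    acyclic  : Acyclic (Induced (arcs B) T)

  unique-in-class : ∀ {y y'} → T y ≡ true → T y' ≡ true → π y ≡ π y' → y ≡ y'
  unique-in-class {y} {y'} ty ty' πy≡πy' =
    count-one-unique _ (one-each (π y) (within y ty))
      (∧-intro (dec-true (π y ≟ π y) refl) ty) (∧-intro (dec-true (π y' ≟ π y) (sym πy≡πy')) ty')

open PartialTransversal

missed-by : ∀ {n m} {π : Fin m → Fin n} {B : Adj m} {U T w} → PartialTransversal π B U T →
  U w ≡ false → ∀ y → T y ≡ true → π y ≢ w
missed-by {U = U} P Uw≡false y ty refl = true≢false (trans (sym (within P y ty)) Uw≡false)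

empty-partial : ∀ {n m} (π : Fin m → Fin n) (B : Adj m) → PartialTransversal π B (λ _ → false) (λ _ → false)
empty-partial π B = record
  { within = λ _ ()
  ; one-each = λ _ ()
  ; acyclic = λ { (_ , _ , _ , _ , () , _) } }

partial-insert : ∀ {n m} {π : Fin m → Fin n} {B : Adj m} {U T} {x u} → (∀ y → B y y ≡ false) →
  PartialTransversal π B U T → π x ≡ u → U u ≡ false → SinkOrSource B T x →
  PartialTransversal π B (insert U u) (insert T x)
partial-insert {π = π} {B} {U} {T} {x} {u} loopless P refl Uu≡false sinkOrSource = record
  { within = within'
  ; one-each = one-each'
  ; acyclic = acyclic-insert B T x loopless (acyclic P) sinkOrSource }
  where
  within' : ∀ y → insert T x y ≡ true → insert U u (π y) ≡ true
  within' y ty with ∨-elim {T y} ty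
  ... | inj₁ ty' = ∨-introˡ (within P y ty')
  ... | inj₂ y≡x = ∨-introʳ (dec-true (π y ≟ π x) (cong π (does-sound (y ≟ x) y≡x)))

  -- x is the only chosen vertex of its class, since U u is false
  only-x : ∀ y → (inX π u y ∧ insert T x y) ≡ true → y ≡ x
  only-x y r with y ≟ x
  ... | yes y≡x = y≡x
  ... | no _ = ⊥-elim (true≢false (trans (sym Uu≡true) Uu≡false))
    where
    Uu≡true : U (π x) ≡ true
    Uu≡true = subst (λ z → U z ≡ true) (does-sound (π y ≟ π x) (∧-elimˡ r))
                (within P y (trans (sym (∨-identityʳ (T y))) (∧-elimʳ r)))

  one-each' : ∀ u' → insert U u u' ≡ true → count (λ y → inX π u' y ∧ insert T x y) ≡ 1
  one-each' u' r with u' ≟ π x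
  ... | yes refl = count-one _ x (∧-intro (dec-true (π x ≟ π x) refl) (∨-introʳ (dec-true (x ≟ x) refl))) only-x
  ... | no u'≢u = trans (count-cong unchanged) (one-each P u' (trans (sym (∨-identityʳ (U u'))) r))
    where
    unchanged : ∀ y → (inX π u' y ∧ insert T x y) ≡ (inX π u' y ∧ T y)
    unchanged y with y ≟ x
    ... | yes refl rewrite dec-false (π x ≟ u') (λ e → u'≢u (sym e)) = refl
    ... | no _ rewrite ∨-identityʳ (T y) = refl

others : ∀ {n} → Fin n → Fin n → Bool
others v u = not (does (u ≟ v))

others-intro : ∀ {n} {v u : Fin n} → u ≢ v → others v u ≡ true
others-intro {v = v} {u} u≢v = cong not (dec-false (u ≟ v) u≢v)

others-elim : ∀ {n} {v u : Fin n} → others v u ≡ true → u ≢ v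
others-elim {v = v} {u} r refl = true≢false (trans (sym r) (cong not (dec-true (v ≟ v) refl)))

deleted⇒partial : ∀ {n m} {π : Fin m → Fin n} {B : Adj m} {v T} →
  IsAcyclicTransversalDel π B v T → PartialTransversal π B (others v) T
deleted⇒partial {π = π} {B} {v} {T} ((avoids-v , one-each-other) , acyclicDel) = record
  { within = λ x tx → others-intro (avoids-v x tx)
  ; one-each = λ u r → one-each-other u (others-elim r)
  ; acyclic = acyclic-sub (Induced (arcsDel π B v) T) (Induced (arcs B) T)
                (λ (tx , ty , b) → tx , ty , avoids-v _ tx , avoids-v _ ty , b) acyclicDel }

partial⇒deleted : ∀ {n m} {π : Fin m → Fin n} {B : Adj m} {U T} {v} → PartialTransversal π B U T →
  U v ≡ false → (∀ u → u ≢ v → U u ≡ true) → IsAcyclicTransversalDel π B v T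
partial⇒deleted {π = π} {B} {U} {T} P Uv≡false others-coloured =
  ((λ x tx πx≡v → true≢false (trans (sym (subst (λ z → U z ≡ true) πx≡v (within P x tx))) Uv≡false)) ,
   (λ u u≢v → one-each P u (others-coloured u u≢v))) ,
  acyclic-sub (Induced (arcs B) T) (Induced (arcsDel π B _) T)
    (λ (tx , ty , (_ , _ , b)) → tx , ty , b) (acyclic P)

partial⇒colorable : ∀ {n m} {π : Fin m → Fin n} {B : Adj m} {U T} →
  PartialTransversal π B U T → (∀ u → U u ≡ true) → Colorable π B
partial⇒colorable {T = T} P all-coloured = T , (λ u → one-each P u (all-coloured u)) , acyclic P

-- In an uncolorable configuration no vertex of X_v is a sink or a source relative to an
-- acyclic transversal T of (X,H)/v: adding it to T would colour D.
uncolorable⇒no-sink-or-source : ∀ {n m} {π : Fin m → Fin n} {B : Adj m} {v T x} → (∀ y → B y y ≡ false) →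
  ¬ Colorable π B → IsAcyclicTransversalDel π B v T → π x ≡ v → ¬ SinkOrSource B T x
uncolorable⇒no-sink-or-source {v = v} loopless uncolorable transversal πx≡v sink-or-source =
  uncolorable (partial⇒colorable extended all-coloured)
  where
  extended = partial-insert loopless (deleted⇒partial transversal) πx≡v
               (cong not (dec-true (v ≟ v) refl)) sink-or-source
  all-coloured : ∀ u → insert (others v) v u ≡ true
  all-coloured u with u ≟ v
  ... | yes _ = refl
  ... | no _ = refl

record PerfectPairing {m} (E : Adj m) (L R : Fin m → Bool) : Set where
  field
    partnerʳ : ∀ x → L x ≡ true → ∃ λ y → R y ≡ true × E x y ≡ true
    partnerˡ : ∀ y → R y ≡ true → ∃ λ x → L x ≡ true × E x y ≡ true
    uniqueˡ  : ∀ {x x' y} → L x ≡ true → L x' ≡ true → R y ≡ true →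
               E x y ≡ true → E x' y ≡ true → x ≡ x'
    uniqueʳ  : ∀ {x y y'} → L x ≡ true → R y ≡ true → R y' ≡ true →
               E x y ≡ true → E x y' ≡ true → y ≡ y'

open PerfectPairing

transpose : ∀ {m} {E : Adj m} {L R} → PerfectPairing E L R → PerfectPairing (λ x y → E y x) R L
transpose P = record
  { partnerʳ = partnerˡ P
  ; partnerˡ = partnerʳ P
  ; uniqueˡ = λ rx rx' ly → uniqueʳ P ly rx rx'
  ; uniqueʳ = λ rx ly ly' → uniqueˡ P ly ly' rx }

pairing-by-counting : ∀ {m} (E : Adj m) (L R : Fin m → Bool) →
  (∀ x → L x ≡ true → ∃ λ y → R y ≡ true × E x y ≡ true) →
  (∀ {x x' y} → L x ≡ true → L x' ≡ true → E x y ≡ true → E x' y ≡ true → x ≡ x') →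
  count R ≤ count L → PerfectPairing E L R
pairing-by-counting E L R partner injective R≤L = record
  { partnerʳ = partner
  ; partnerˡ = injective-onto L R E partner injective R≤L
  ; uniqueˡ = λ lx lx' _ → injective lx lx'
  ; uniqueʳ = λ lx ry ry' → injective-functional L R (λ x y → E x y ≡ true) partner injective R≤L lx ry ry' }

-- E is H or its reverse; the E-arcs leaving
-- X_u land in the classes N (the out- resp. in-neighbourhood of u in D) and form matchings,
-- |N| ≤ |X_u| by degree-feasibility, and T meets every class at most once.
module Orientation {n m} (π : Fin m → Fin n) (E : Adj m) (T : Fin m → Bool) (u : Fin n)
  (N : Fin n → Bool)
  (T-unique : ∀ {y y'} → T y ≡ true → T y' ≡ true → π y ≡ π y' → y ≡ y')
  (E-matching : ∀ {x x' y} → π x ≡ π x' → E x y ≡ true → E x' y ≡ true → x ≡ x')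
  (E-lands : ∀ {x y} → π x ≡ u → E x y ≡ true → N (π y) ≡ true)
  (N≤X : count N ≤ size π u) where

  neighbour-or-sink : ∀ x → (∃ λ y → T y ≡ true × E x y ≡ true) ⊎ Sink E T x
  neighbour-or-sink x with any? (λ y → T y ∧ E x y ≟ᵇ true)
  ... | yes (y , r) = inj₁ (y , ∧-elimˡ r , ∧-elimʳ r)
  ... | no none = inj₂ (λ y ty → ¬-not (λ e → none (y , ∧-intro ty e)))

  sink? : ∀ x → Dec (Sink E T x)
  sink? x with neighbour-or-sink x
  ... | inj₁ (y , ty , e) = no (λ sink → true≢false (trans (sym e) (sink y ty)))
  ... | inj₂ sink = yes sink

  neighbour : ∀ x → ¬ Sink E T x → ∃ λ y → T y ≡ true × E x y ≡ true
  neighbour x not-sink with neighbour-or-sink x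
  ... | inj₁ nb = nb
  ... | inj₂ sink = ⊥-elim (not-sink sink)

  -- If T misses some class w of N, some x ∈ X_u is an E-sink relative to T: otherwise sending
  -- each x to the class of an E-neighbour in T injects X_u into N - w, against |N| ≤ |X_u|.
  sink-vertex : ∀ w → N w ≡ true → (∀ y → T y ≡ true → π y ≢ w) → ∃ λ x → π x ≡ u × Sink E T x
  sink-vertex w Nw missed with any? (λ x → (π x ≟ u) ×-dec sink? x)
  ... | yes (x , πx≡u , sink) = x , πx≡u , sink
  ... | no no-sink-found = ⊥-elim (1+n≰n (≤-trans (≤-reflexive (count-remove N w Nw)) (≤-trans N≤X X≤N-w)))
    where
    ClassOfNeighbour : Fin m → Fin n → Set
    ClassOfNeighbour x z = ∃ λ y → (T y ≡ true × E x y ≡ true) × π y ≡ z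

    X≤N-w : size π u ≤ count (remove N w)
    X≤N-w = count-≤-injective (inX π u) (remove N w) ClassOfNeighbour
      (λ x r → let πx≡u = does-sound (π x ≟ u) r
                   (y , ty , e) = neighbour x (λ sink → no-sink-found (x , πx≡u , sink))
               in π y , remove-intro {q = N} (missed y ty) (E-lands πx≡u e) , (y , (ty , e) , refl))
      (λ { rx rx' (y , (ty , e) , refl) (y' , (ty' , e') , πy'≡πy) →
           E-matching (trans (does-sound (_ ≟ u) rx) (sym (does-sound (_ ≟ u) rx'))) e
             (subst (λ z → E _ z ≡ true) (T-unique ty' ty πy'≡πy) e') })

  -- The vertices of T in the classes N; as T meets every class at most once, |TN| ≤ |N|.
  TN : Fin m → Bool
  TN y = T y ∧ N (π y)

  TN≤N : count TN ≤ count N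
  TN≤N = count-≤-injective TN N (λ y z → π y ≡ z) (λ y r → π y , ∧-elimʳ {T y} r , refl)
           (λ ty ty' e e' → T-unique (∧-elimˡ ty) (∧-elimˡ ty') (trans e (sym e')))

  -- If no x ∈ X_u is an E-sink relative to T, then X_u injects into TN, which injects into N;
  -- so |X_u| = |N| and E pairs X_u perfectly with TN.
  saturation : (∀ x → π x ≡ u → ¬ Sink E T x) → size π u ≡ count N × PerfectPairing E (inX π u) TN
  saturation no-sinks = ≤-antisym (≤-trans X≤TN TN≤N) N≤X ,
                         pairing-by-counting E (inX π u) TN partner injective (≤-trans TN≤N N≤X)
    where
    partner : ∀ x → inX π u x ≡ true → ∃ λ y → TN y ≡ true × E x y ≡ true
    partner x r with neighbour x (no-sinks x (does-sound (π x ≟ u) r))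
    ... | y , ty , e = y , ∧-intro ty (E-lands (does-sound (π x ≟ u) r) e) , e

    injective : ∀ {x x' y} → inX π u x ≡ true → inX π u x' ≡ true → E x y ≡ true → E x' y ≡ true → x ≡ x'
    injective rx rx' = E-matching (trans (does-sound (_ ≟ u) rx) (sym (does-sound (_ ≟ u) rx')))

    X≤TN : size π u ≤ count TN
    X≤TN = count-≤-injective (inX π u) TN (λ x y → E x y ≡ true) partner injective

pairing⇒perfect-matching : ∀ {m} (B : Adj m) (L R W : Fin m → Bool) →
  (∀ z → L z ≡ true → R z ≡ true → ⊥) →
  (∀ z → W z ≡ true → L z ≡ true ⊎ R z ≡ true) →
  (∀ z → L z ≡ true ⊎ R z ≡ true → W z ≡ true) →
  PerfectPairing B L R → IsPerfectMatchingOf (arcsFromTo B L R) W (Induced (arcs B) W)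
pairing⇒perfect-matching B L R W disjoint W⊆L∪R L∪R⊆W P = in-H[W] , matching , covering
  where
  in-H[W] : ∀ x y → arcsFromTo B L R x y → Induced (arcs B) W x y
  in-H[W] x y (lx , ry , b) = L∪R⊆W x (inj₁ lx) , L∪R⊆W y (inj₂ ry) , b

  matching : IsMatching (arcsFromTo B L R)
  matching (lx , ry , b) (_ , ry' , b') (inj₁ refl) = refl , uniqueʳ P lx ry ry' b b'
  matching (lx , _ , _) (_ , ry' , _) (inj₂ (inj₁ refl)) = ⊥-elim (disjoint _ lx ry')
  matching (_ , ry , _) (lx' , _ , _) (inj₂ (inj₂ (inj₁ refl))) = ⊥-elim (disjoint _ lx' ry)
  matching (lx , ry , b) (lx' , _ , b') (inj₂ (inj₂ (inj₂ refl))) = uniqueˡ P lx lx' ry b b' , refl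

  covering : ∀ z → W z ≡ true → ∃ λ x → ∃ λ y → arcsFromTo B L R x y × (z ≡ x ⊎ z ≡ y)
  covering z wz with W⊆L∪R z wz
  ... | inj₁ lz = let (y , ry , b) = partnerʳ P z lz in z , y , (lz , ry , b) , inj₁ refl
  ... | inj₂ rz = let (x , lx , b) = partnerˡ P z rz in x , z , (lx , rz , b) , inj₂ refl

first : (ℕ → Bool) → ℕ → ℕ
first f zero = 0
first f (suc N) = if f 0 then 0 else suc (first (λ j → f (suc j)) N)

first-holds : ∀ (f : ℕ → Bool) N → f N ≡ true → f (first f N) ≡ true
first-holds f zero fN = fN
first-holds f (suc N) fN with f 0 in f0
... | true = f0
... | false = first-holds (λ j → f (suc j)) N fN

first-least : ∀ (f : ℕ → Bool) N {j} → j < first f N → f j ≡ false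
first-least f (suc N) {j} j<first with f 0 in f0
first-least f (suc N) {zero} _ | false = f0
first-least f (suc N) {suc j} (s≤s j<first) | false = first-least (λ j → f (suc j)) N j<first

-- The greedy colouring of part (b)
-- only needs that dist v = 0 and that every other vertex has a strictly closer neighbour.
module Distance {n} (A : Adj n) (connected : Connected A) (v : Fin n) where

  adjacent : Fin n → Fin n → Bool
  adjacent u w = A u w ∨ A w u

  reach : ℕ → Fin n → Bool
  reach zero u = does (u ≟ v)
  reach (suc j) u = reach j u ∨ does (any? (λ w → adjacent u w ∧ reach j w ≟ᵇ true))

  reachable : ∀ {u} → WeakWalk A u v → ∃ λ j → reach j u ≡ true
  reachable here = 0 , dec-true (v ≟ v) refl
  reachable (fwd {w = w} a walk) with reachable walk
  ... | j , r = suc j , ∨-introʳ (dec-true (any? _) (w , ∧-intro (∨-introˡ a) r))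
  reachable {u} (bwd {w = w} a walk) with reachable walk
  ... | j , r = suc j , ∨-introʳ (dec-true (any? _) (w , ∧-intro (∨-introʳ {A u w} a) r))

  -- a walk to v bounds the search for the distance
  bound : Fin n → ℕ
  bound u = proj₁ (reachable (connected u v))

  dist : Fin n → ℕ
  dist u = first (λ j → reach j u) (bound u)

  dist-reach : ∀ u → reach (dist u) u ≡ true
  dist-reach u = first-holds (λ j → reach j u) (bound u) (proj₂ (reachable (connected u v)))

  dist-least : ∀ u {j} → j < dist u → reach j u ≡ false
  dist-least u = first-least (λ j → reach j u) (bound u)

  dist-≤ : ∀ u {j} → reach j u ≡ true → dist u ≤ j
  dist-≤ u {j} r with ≤-<-connex (dist u) j
  ... | inj₁ dist≤j = dist≤j
  ... | inj₂ j<dist = ⊥-elim (true≢false (trans (sym r) (dist-least u j<dist)))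

  dist-root : dist v ≡ 0
  dist-root = n≤0⇒n≡0 (dist-≤ v (dec-true (v ≟ v) refl))

  descent : ∀ u → u ≢ v → ∃ λ w → adjacent u w ≡ true × dist w < dist u
  descent u u≢v = descend (dist u) (dist-reach u) (dist-least u)
    where
    descend : ∀ d → reach d u ≡ true → (∀ {j} → j < d → reach j u ≡ false) →
              ∃ λ w → adjacent u w ≡ true × dist w < d
    descend zero r _ = ⊥-elim (u≢v (does-sound (u ≟ v) r))
    descend (suc j) r below with ∨-elim {reach j u} r
    ... | inj₁ rj = ⊥-elim (true≢false (trans (sym rj) (below ≤-refl)))
    ... | inj₂ some with does-sound (any? _) some
    ...   | w , r' = w , ∧-elimˡ r' , s≤s (dist-≤ w (∧-elimʳ {adjacent u w} r'))

empty-or-maximal : ∀ {k} (p : Fin k → Bool) (f : Fin k → ℕ) →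
  (∀ x → p x ≡ false) ⊎ ∃ λ u → p u ≡ true × (∀ w → p w ≡ true → f w ≤ f u)
empty-or-maximal {zero} p f = inj₁ (λ ())
empty-or-maximal {suc k} p f with empty-or-maximal (λ x → p (suc x)) (λ x → f (suc x)) | p zero in p0
... | inj₁ none | false = inj₁ λ { zero → p0 ; (suc x) → none x }
... | inj₁ none | true =
  inj₂ (zero , p0 , λ { zero _ → ≤-refl ; (suc x) px → ⊥-elim (true≢false (trans (sym px) (none x))) })
... | inj₂ (u , pu , max) | false =
  inj₂ (suc u , pu , λ { zero pz → ⊥-elim (true≢false (trans (sym pz) p0)) ; (suc x) px → max x px })
... | inj₂ (u , pu , max) | true with ≤-total (f zero) (f (suc u))
...   | inj₁ f0≤ = inj₂ (suc u , pu , λ { zero _ → f0≤ ; (suc x) px → max x px })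
...   | inj₂ ≤f0 = inj₂ (zero , p0 , λ { zero _ → ≤-refl ; (suc x) px → ≤-trans (max x px) ≤f0 })

maximal : ∀ {k} (p : Fin k → Bool) (f : Fin k → ℕ) → ∃ (λ x → p x ≡ true) →
  ∃ λ u → p u ≡ true × (∀ w → p w ≡ true → f w ≤ f u)
maximal p f (x , px) with empty-or-maximal p f
... | inj₁ none = ⊥-elim (true≢false (trans (sym px) (none x)))
... | inj₂ max = max

module Greedy {n m} {A : Adj n} {π : Fin m → Fin n} {B : Adj m}
  (cover : IsCover A π B) (degree-feasible : DegreeFeasible A π) where
  open CoverFacts cover

  -- If an uncoloured class u has an uncoloured neighbour w in D, some vertex of X_u is a sink
  -- or a source relative to T: at most deg(u) - 1 neighbour classes of u meet T, fewer than |X_u|.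
  sink-or-source-next-to-uncoloured : ∀ {U T u w} → PartialTransversal π B U T →
    U w ≡ false → A u w ≡ true ⊎ A w u ≡ true → ∃ λ x → π x ≡ u × SinkOrSource B T x
  sink-or-source-next-to-uncoloured {U} {T} {u} {w} P Uw≡false (inj₁ Auw)
    with Orientation.sink-vertex π B T u (A u) (unique-in-class P) in-unique
           (λ {x} {y} πx≡u b → subst (λ z → A z (π y) ≡ true) πx≡u (arc-projects b))
           (≤-trans (m≤m⊔n _ _) (degree-feasible u)) w Auw (missed-by P Uw≡false)
  ... | x , πx≡u , sink = x , πx≡u , inj₁ sink
  sink-or-source-next-to-uncoloured {U} {T} {u} {w} P Uw≡false (inj₂ Awu)
    with Orientation.sink-vertex π (λ x y → B y x) T u (λ z → A z u) (unique-in-class P) out-unique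
           (λ {x} {y} πx≡u b → subst (λ z → A (π y) z ≡ true) πx≡u (arc-projects b))
           (≤-trans (m≤n⊔m _ _) (degree-feasible u)) w Awu (missed-by P Uw≡false)
  ... | x , πx≡u , source = x , πx≡u , inj₂ source

  module Towards (connected : Connected A) (v : Fin n) where
    open Distance A connected v

    Pending : (Fin n → Bool) → Fin n → Bool
    Pending U z = not (U z) ∧ others v z

    Closed : (Fin n → Bool) → Set
    Closed U = U v ≡ false × (∀ a w → U a ≡ true → dist a < dist w → U w ≡ true)

    closed-insert : ∀ {U u} → Closed U → Pending U u ≡ true →
      (∀ w → Pending U w ≡ true → dist w ≤ dist u) → Closed (insert U u)
    closed-insert {U} {u} (Uv≡false , closed) pu farthest = Uv'≡false , closed'
      where
      Uv'≡false : insert U u v ≡ false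
      Uv'≡false = trans (cong (_∨ does (v ≟ u)) Uv≡false)
                        (dec-false (v ≟ u) (λ v≡u → others-elim (∧-elimʳ {not (U u)} pu) (sym v≡u)))

      closed' : ∀ a w → insert U u a ≡ true → dist a < dist w → insert U u w ≡ true
      closed' a w r a<w with ∨-elim {U a} r
      ... | inj₁ Ua = ∨-introˡ (closed a w Ua a<w)
      ... | inj₂ a≡u with U w in Uw
      ...   | true = refl
      ...   | false = ⊥-elim (<⇒≱ u<w (farthest w (∧-intro (cong not Uw) (others-intro w≢v))))
        where
        u<w : dist u < dist w
        u<w = subst (λ z → dist z < dist w) (does-sound (a ≟ u) a≡u) a<w
        w≢v : w ≢ v
        w≢v refl = n≮0 (subst (dist a <_) dist-root a<w)

    pending-insert : ∀ {U u} → Pending U u ≡ true →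
      suc (count (Pending (insert U u))) ≡ count (Pending U)
    pending-insert {U} {u} pu =
      trans (cong suc (count-cong (λ z → not-∨-∧ (U z) (does (z ≟ u)) (others v z))))
            (count-remove (Pending U) u pu)
      where
      not-∨-∧ : ∀ a b c → not (a ∨ b) ∧ c ≡ not b ∧ (not a ∧ c)
      not-∨-∧ true true _ = refl
      not-∨-∧ true false _ = refl
      not-∨-∧ false true _ = refl
      not-∨-∧ false false _ = refl

    uncoloured-closer : ∀ {U u w} → Closed U → U u ≡ false → dist w < dist u → U w ≡ false
    uncoloured-closer {U} {u} {w} (_ , closed) Uu≡false w<u with U w in Uw
    ... | false = refl
    ... | true = ⊥-elim (true≢false (trans (sym (closed w u Uw w<u)) Uu≡false))

    extend : ∀ k U T → Closed U → PartialTransversal π B U T → count (Pending U) ≡ k →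
      ∃ λ T' → IsAcyclicTransversalDel π B v T'
    extend zero U T (Uv≡false , _) P none = T , partial⇒deleted P Uv≡false others-coloured
      where
      others-coloured : ∀ u → u ≢ v → U u ≡ true
      others-coloured u u≢v with U u in Uu
      ... | true = refl
      ... | false = ⊥-elim (1+n≰n (subst (1 ≤_) none
                      (count-member (Pending U) u (∧-intro (cong not Uu) (others-intro u≢v)))))
    extend (suc k) U T closed P pending
      with maximal (Pending U) dist (count-positive (Pending U) (subst (1 ≤_) (sym pending) (s≤s z≤n)))
    ... | u , pu , farthest with descent u (others-elim (∧-elimʳ {not (U u)} pu))
    ... | w , u~w , w-closer
      with sink-or-source-next-to-uncoloured P (uncoloured-closer closed (not-elim (∧-elimˡ pu)) w-closer)
             (∨-elim u~w)
    ... | x , πx≡u , sink-or-source =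
      extend k (insert U u) (insert T x) (closed-insert closed pu farthest)
        (partial-insert H-loopless P πx≡u (not-elim (∧-elimˡ pu)) sink-or-source)
        (cong pred (trans (pending-insert pu) pending))

  transversal-exists : Connected A → ∀ v → ∃ λ T → IsAcyclicTransversalDel π B v T
  transversal-exists connected v =
    Towards.extend connected v _ (λ _ → false) (λ _ → false) (refl , λ _ _ ()) (empty-partial π B) refl

module Saturated {n m} {A : Adj n} {π : Fin m → Fin n} {B : Adj m}
  (cover : IsCover A π B) (degree-feasible : DegreeFeasible A π) (uncolorable : ¬ Colorable π B)
  (v : Fin n) (T : Fin m → Bool) (transversal : IsAcyclicTransversalDel π B v T) where
  open CoverFacts cover

  P : PartialTransversal π B (others v) T
  P = deleted⇒partial transversal

  no-sink : ∀ x → π x ≡ v → ¬ SinkOrSource B T x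
  no-sink x πx≡v = uncolorable⇒no-sink-or-source H-loopless uncolorable transversal πx≡v

  outgoing : size π v ≡ outdeg A v × PerfectPairing B (inX π v) (Tplus A π v T)
  outgoing = Orientation.saturation π B T v (A v) (unique-in-class P) in-unique
    (λ {x} {y} πx≡v b → subst (λ z → A z (π y) ≡ true) πx≡v (arc-projects b))
    (≤-trans (m≤m⊔n _ _) (degree-feasible v))
    (λ x πx≡v sink → no-sink x πx≡v (inj₁ sink))

  incoming : size π v ≡ indeg A v × PerfectPairing (λ x y → B y x) (inX π v) (Tminus A π v T)
  incoming = Orientation.saturation π (λ x y → B y x) T v (λ z → A z v) (unique-in-class P)
    out-unique (λ {x} {y} πx≡v b → subst (λ z → A (π y) z ≡ true) πx≡v (arc-projects b))
    (≤-trans (m≤n⊔m _ _) (degree-feasible v))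
    (λ x πx≡v source → no-sink x πx≡v (inj₂ source))

  disjoint : ∀ z → inX π v z ≡ true → T z ≡ true → ⊥
  disjoint z xz tz = proj₁ (proj₁ transversal) z tz (does-sound (π z ≟ v) xz)

  perfect-out : IsPerfectMatchingOf (arcsFromTo B (inX π v) (Tplus A π v T))
                  (inX π v ∪ Tplus A π v T) (Induced (arcs B) (inX π v ∪ Tplus A π v T))
  perfect-out = pairing⇒perfect-matching B (inX π v) (Tplus A π v T) (inX π v ∪ Tplus A π v T)
    (λ z xz pz → disjoint z xz (∧-elimˡ pz)) (λ z → ∨-elim) (λ z → [ ∨-introˡ , ∨-introʳ ]′)
    (proj₂ outgoing)

  perfect-in : IsPerfectMatchingOf (arcsFromTo B (Tminus A π v T) (inX π v))
                 (inX π v ∪ Tminus A π v T) (Induced (arcs B) (inX π v ∪ Tminus A π v T))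
  perfect-in = pairing⇒perfect-matching B (Tminus A π v T) (inX π v) (inX π v ∪ Tminus A π v T)
    (λ z pz xz → disjoint z xz (∧-elimˡ pz)) (λ z r → swap (∨-elim r))
    (λ z → [ ∨-introʳ , ∨-introˡ ]′)
    (transpose (proj₂ incoming))

proposition9 : ∀ {n m} (A : Adj n) (π : Fin m → Fin n) (B : Adj m) →
    FeasibleConfig A π B → DegreeFeasible A π → ¬ Colorable π B →
    ((∀ v → size π v ≡ outdeg A v × size π v ≡ indeg A v) × Eulerian A)
    × (∀ v → ∃[ T ] IsAcyclicTransversalDel π B v T)
    × (∀ v T → IsAcyclicTransversalDel π B v T →
        IsPerfectMatchingOf (arcsFromTo B (inX π v) (Tplus A π v T))
                            (inX π v ∪ Tplus A π v T)
                            (Induced (arcs B) (inX π v ∪ Tplus A π v T))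
        × IsPerfectMatchingOf (arcsFromTo B (Tminus A π v T) (inX π v))
                              (inX π v ∪ Tminus A π v T)
                              (Induced (arcs B) (inX π v ∪ Tminus A π v T)))
proposition9 A π B (_ , connected , cover) degree-feasible uncolorable =
  (sizes , eulerian) , transversal , (λ v T t → Sat.perfect-out v T t , Sat.perfect-in v T t)
  where
  module Sat = Saturated cover degree-feasible uncolorable

  transversal : ∀ v → ∃[ T ] IsAcyclicTransversalDel π B v T
  transversal = Greedy.transversal-exists cover degree-feasible connected


  sizes : ∀ v → size π v ≡ outdeg A v × size π v ≡ indeg A v
  sizes v with transversal v
  ... | T , t = proj₁ (Sat.outgoing v T t) , proj₁ (Sat.incoming v T t)

  eulerian : Eulerian A
  eulerian v = trans (sym (proj₁ (sizes v))) (proj₂ (sizes v))
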